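{- Let $w \ge 1$ be an integer and $J_m = (2^m-(-1)^m)/3$. For every integer $N$ with $J_w < N \le J_{w+1}$ we have $a(N) = w$.
   Context: Setting (alternator coin problem): There are $N$ identical-looking coins. All but one are real and have the same weight. The remaining coin, the alternator, behaves as follows: each time it is placed on a balance scale it weighs either the same as a real coin ("acts real") or strictly less than a real coin ("acts fake"), and it switches between these two behaviours every time it is on the scale; while off the scale its behaviour does not change. A weighing places two disjoint sets of coins with the same number of coins on the two pans, and its outcome is one of: the pans balance, the left pan is lighter, or the right pan is lighter. Weighings may be chosen adaptively based on earlier outcomes. A strategy finds the alternator if, for every possible identity of the alternator and every possible starting behaviour, the outcomes determine which coin it is. $a(N)$ is the smallest number of weighings that guarantees finding the alternator among $N$ coins when it is not known whether its first appearance on the scale will be as a real or as a fake coin. $J_m=(2^m-(-1)^m)/3$ is the $m$-th Jacobsthal number ($J_0=0,J_1=1,J_2=1,J_3=3,J_4=5,\dots$). -}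

module Defs where

open import Data.Nat using (ℕ; zero; suc; _+_; _∸_; _^_; _<_; _≤_; _%_; _/_; _≡ᵇ_)
open import Data.Bool using (Bool; true; false; not; if_then_else_)
open import Data.Fin using (Fin)
open import Data.Fin.Subset using (Subset; Side; inside; outside; ∣_∣; _∩_; Empty)
open import Data.Vec using (lookup)
open import Data.Product using (Σ; _×_)
open import Relation.Binary.PropositionalEquality using (_≡_)
open import Relation.Nullary using (¬_)

-- Jacobsthal numbers J m = (2^m - (-1)^m)/3, written out in ℕ:
-- for even m this is (2^m - 1)/3, for odd m it is (2^m + 1)/3.
J : ℕ → ℕ
J m = if (m % 2) ≡ᵇ 0 then (2 ^ m ∸ 1) / 3 else (2 ^ m + 1) / 3

record Weighing (N : ℕ) : Set where
  field
    left     : Subset N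
    right    : Subset N
    disjoint : Empty (left ∩ right)
    sameSize : ∣ left ∣ ≡ ∣ right ∣
open Weighing public

data Outcome : Set where
  balance leftLighter rightLighter : Outcome

data Strategy (N : ℕ) : ℕ → Set where
  guess : ∀ {k} → Fin N → Strategy N k
  weigh : ∀ {k} → Weighing N → (Outcome → Strategy N k) → Strategy N (suc k)

onPan : ∀ {N} → Subset N → Fin N → Bool
onPan p i with lookup p i
... | inside  = true
... | outside = false

-- Outcome of a weighing when coin i is the alternator and its next appearance
-- on the scale is as a fake (fakeNext = true) or as a real coin (false).
outcome : ∀ {N} → Weighing N → Fin N → Bool → Outcome
outcome W i fakeNext with onPan (left W) i | onPan (right W) i | fakeNext
... | true  | _     | true = leftLighter
... | false | true  | true = rightLighter
... | _     | _     | _    = balance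

-- The alternator switches behaviour exactly when it is placed on the scale.
nextState : ∀ {N} → Weighing N → Fin N → Bool → Bool
nextState W i fakeNext with onPan (left W) i | onPan (right W) i
... | false | false = fakeNext
... | _     | _     = not fakeNext

run : ∀ {N k} → Strategy N k → Fin N → Bool → Fin N
run (guess c)   i s = c
run (weigh W f) i s = run (f (outcome W i s)) i (nextState W i s)

Finds : ∀ {N k} → Strategy N k → Set
Finds {N} {k} S = ∀ (i : Fin N) (s : Bool) → run S i s ≡ i

aIs : ℕ → ℕ → Set
aIs N w = Σ (Strategy N w) Finds × (∀ k → k < w → (S : Strategy N k) → ¬ Finds S)

module Submission where

open import Defs
open import Data.Nat using (ℕ; _<_; _≤_; suc)

open import Data.Nat
  using (zero; _+_; _*_; _∸_; _^_; _%_; _⊓_; _<ᵇ_; ⌊_/2⌋; z≤n; s≤s)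
open import Data.Nat.Properties
open import Data.Nat.DivMod using (m*n/n≡m; %-distribˡ-+)
open import Data.Nat.ListAction using () renaming (sum to listSum)
open import Data.Nat.Tactic.RingSolver using (solve-∀)
open import Data.Bool using (Bool; true; false; if_then_else_; not; _∧_; _∨_; T)
open import Data.Bool.Properties using (∧-zeroʳ; ∧-identityʳ; ∧-assoc; ∧-comm; T-≡)
import Data.Bool.Properties as Bool
open import Data.Product using (_×_; _,_; proj₁; proj₂; ∃)
open import Data.Product.Properties using (≡-dec)
open import Data.Sum using (inj₁; inj₂)
open import Data.Empty using (⊥-elim)
open import Data.Fin using (Fin; zero; suc)
open import Data.Fin.Properties using (any?)
import Data.Fin.Properties as Fin
open import Data.Fin.Subset using (Subset; ∣_∣; _∩_)
open import Data.Vec using (tabulate; lookup)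
open import Data.Vec.Properties using (lookup∘tabulate; lookup-zipWith; []=⇒lookup)
open import Data.List using (List; []; _∷_; cartesianProduct)
import Data.List as List
open import Data.List.Properties using (map-cong)
open import Data.List.Membership.Propositional using (_∈_)
open import Data.List.Membership.Propositional.Properties using (∈-cartesianProduct⁺)
open import Data.List.Relation.Unary.Any using (here; there)
import Data.List.Relation.Unary.All as All
open import Function using (_∘_; Equivalence)
open import Relation.Nullary using (¬_; yes; no; Dec; does; contradiction)
open import Relation.Nullary.Decidable using (True; toWitness; T?)
open import Relation.Binary.PropositionalEquality hiding (J)
open import Algebra.Properties.CommutativeMonoid.Sum +-0-commutativeMonoid
  using (sum; ∑-distrib-+; sum-cong-≗)

-- After some weighings, what is known is a status for every coin: which of the two
-- behaviours (fake / real) it may still show at its next weighing if it is the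
-- alternator.
--
-- Lower bound (capacity): a strategy with k weighings left allows at most Jac (k+1)
-- coins that may act real next and at most Jac (k+2) candidates, since a balance keeps
-- every coin that may act real and a lighter pan keeps only coins that then act real.
-- With N unknown coins this gives N ≤ Jac (k+1), so fewer than w weighings fail.
--
-- Upper bound: the strategy puts half of the unknown and of the real coins, and half of
-- the fake coins but at most Jac k, on each pan.  The census of every outcome is read
-- off the preimage table of the cells, and the arithmetic invariant Solvable on the
-- census is preserved down to a single candidate.

Jac : ℕ → ℕ
Jac zero          = 0
Jac (suc zero)    = 1
Jac (suc (suc m)) = Jac (suc m) + 2 * Jac m

-- The closed form 3 · Jac m = 2^m - (-1)^m, carried together with the
-- alternating relation Jac (m + 1) = 2 · Jac m + (-1)^m, split by the parity of m.
data Phase (m : ℕ) : Set where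
  even : m % 2 ≡ 0 → 2 ^ m ≡ 3 * Jac m + 1 → Jac (suc m) ≡ 2 * Jac m + 1 → Phase m
  odd  : m % 2 ≡ 1 → 2 ^ m + 1 ≡ 3 * Jac m → Jac (suc m) + 1 ≡ 2 * Jac m → Phase m

-- The step odd → even in ℕ, where the closed form involves a subtraction.
odd-to-even : ∀ p x y → p + 1 ≡ 3 * y → x + 1 ≡ 2 * y → 2 * p ≡ 3 * x + 1
odd-to-even p x y p+1≡3y x+1≡2y = +-cancelʳ-≡ 2 _ _ (begin
  2 * p + 2      ≡⟨ *-distribˡ-+ 2 p 1 ⟨
  2 * (p + 1)    ≡⟨ cong (2 *_) p+1≡3y ⟩
  2 * (3 * y)    ≡⟨ *-comm 2 (3 * y) ⟩
  3 * y * 2      ≡⟨ *-assoc 3 y 2 ⟩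
  3 * (y * 2)    ≡⟨ cong (3 *_) (trans (*-comm y 2) (sym x+1≡2y)) ⟩
  3 * (x + 1)    ≡⟨ *-distribˡ-+ 3 x 1 ⟩
  3 * x + 3      ≡⟨ +-assoc (3 * x) 1 2 ⟨
  3 * x + 1 + 2  ∎)
  where open ≡-Reasoning

phase : ∀ m → Phase m
phase zero = even refl refl refl
phase (suc m) with phase m
... | even m%2≡0 pow next = odd parity pow′ next′
  where
  parity : suc m % 2 ≡ 1
  parity = trans (%-distribˡ-+ 1 m 2) (cong (λ r → (1 + r) % 2) m%2≡0)
  pow′ : 2 ^ suc m + 1 ≡ 3 * Jac (suc m)
  pow′ rewrite pow | next = identity (Jac m)
    where
    identity : ∀ y → 2 * (3 * y + 1) + 1 ≡ 3 * (2 * y + 1)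
    identity = solve-∀
  next′ : Jac (suc (suc m)) + 1 ≡ 2 * Jac (suc m)
  next′ rewrite next = identity (Jac m)
    where
    identity : ∀ y → 2 * y + 1 + 2 * y + 1 ≡ 2 * (2 * y + 1)
    identity = solve-∀
... | odd m%2≡1 pow next = even parity (odd-to-even (2 ^ m) (Jac (suc m)) (Jac m) pow next) next′
  where
  parity : suc m % 2 ≡ 0
  parity = trans (%-distribˡ-+ 1 m 2) (cong (λ r → (1 + r) % 2) m%2≡1)
  next′ : Jac (suc (suc m)) ≡ 2 * Jac (suc m) + 1
  next′ rewrite sym next = identity (Jac (suc m))
    where
    identity : ∀ x → x + (x + 1) ≡ 2 * x + 1
    identity = solve-∀

J≡Jac : ∀ m → J m ≡ Jac m
J≡Jac m with phase m
... | even m%2≡0 pow _ rewrite m%2≡0 | pow | m+n∸n≡m (3 * Jac m) 1 | *-comm 3 (Jac m) = m*n/n≡m (Jac m) 3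
... | odd  m%2≡1 pow _ rewrite m%2≡1 | pow | *-comm 3 (Jac m) = m*n/n≡m (Jac m) 3

Jac-positive : ∀ m → 1 ≤ Jac (suc m)
Jac-positive zero    = ≤-refl
Jac-positive (suc m) = ≤-trans (Jac-positive m) (m≤m+n _ _)

Jac-monotone : ∀ {m n} → m ≤ n → Jac m ≤ Jac n
Jac-monotone {n = zero}  z≤n = z≤n
Jac-monotone {m} {suc n} m≤1+n with m≤n⇒m<n∨m≡n m≤1+n
... | inj₁ m<1+n = ≤-trans (Jac-monotone (≤-pred m<1+n)) (one-step n)
  where
  one-step : ∀ n → Jac n ≤ Jac (suc n)
  one-step zero    = z≤n
  one-step (suc n) = m≤m+n _ _
... | inj₂ refl  = ≤-refl

Jac-growth : ∀ m → Jac (suc m) ≤ 2 * Jac m + 1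
Jac-growth m with phase m
... | even _ _ next = ≤-reflexive next
... | odd  _ _ next = ≤-trans (m≤m+n _ 1) (≤-trans (≤-reflexive next) (m≤m+n _ 1))

indicator : Bool → ℕ
indicator true  = 1
indicator false = 0

count : ∀ {n} → (Fin n → Bool) → ℕ
count P = sum (indicator ∘ P)

sum-mono : ∀ {n} {f g : Fin n → ℕ} → (∀ i → f i ≤ g i) → sum f ≤ sum g
sum-mono {zero}  f≤g = z≤n
sum-mono {suc n} f≤g = +-mono-≤ (f≤g zero) (sum-mono (f≤g ∘ suc))

sum-zero : ∀ n → sum {n} (λ _ → 0) ≡ 0
sum-zero zero    = refl
sum-zero (suc n) = sum-zero n

sum-three : ∀ {n} (f g h : Fin n → ℕ) → sum (λ i → f i + g i + h i) ≡ sum f + sum g + sum h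
sum-three f g h = trans (∑-distrib-+ (λ i → f i + g i) h) (cong (_+ sum h) (∑-distrib-+ f g))

sum-exchange : ∀ {n} {A : Set} (cs : List A) (w : A → Fin n → ℕ) →
               sum (λ i → listSum (List.map (λ c → w c i) cs)) ≡ listSum (List.map (λ c → sum (w c)) cs)
sum-exchange {n} []       w = sum-zero n
sum-exchange     (c ∷ cs) w =
  trans (∑-distrib-+ (w c) (λ i → listSum (List.map (λ c′ → w c′ i) cs)))
        (cong (sum (w c) +_) (sum-exchange cs w))

count-all : ∀ n → count {n} (λ _ → true) ≡ n
count-all zero    = refl
count-all (suc n) = cong suc (count-all n)

count-mono : ∀ {n} {P Q : Fin n → Bool} → (∀ i → T (P i) → T (Q i)) → count P ≤ count Q
count-mono {P = P} {Q} P⇒Q = sum-mono (λ i → indicator-mono (P i) (Q i) (P⇒Q i))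
  where
  indicator-mono : ∀ b c → (T b → T c) → indicator b ≤ indicator c
  indicator-mono false c     _   = z≤n
  indicator-mono true  true  _   = ≤-refl
  indicator-mono true  false b⇒c = ⊥-elim (b⇒c _)

indicator-false : ∀ {b} → ¬ T b → indicator b ≡ 0
indicator-false {false} _  = refl
indicator-false {true}  ¬b = ⊥-elim (¬b _)

indicator≤1 : ∀ b → indicator b ≤ 1
indicator≤1 false = z≤n
indicator≤1 true  = ≤-refl

count-none : ∀ {n} (P : Fin n → Bool) → (∀ i → ¬ T (P i)) → count P ≡ 0
count-none {n} P none = trans (sum-cong-≗ (λ i → indicator-false (none i))) (sum-zero n)

count≤1 : ∀ {n} (P : Fin n → Bool) (c : Fin n) → (∀ i → T (P i) → i ≡ c) → count P ≤ 1
count≤1 P zero only-c = begin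
  indicator (P zero) + count (P ∘ suc)  ≡⟨ cong (indicator (P zero) +_) (count-none (P ∘ suc) later-fail) ⟩
  indicator (P zero) + 0                ≡⟨ +-identityʳ _ ⟩
  indicator (P zero)                    ≤⟨ indicator≤1 (P zero) ⟩
  1                                     ∎
  where
  open ≤-Reasoning
  later-fail : ∀ i → ¬ T (P (suc i))
  later-fail i Pi with only-c (suc i) Pi
  ... | ()
count≤1 P (suc c) only-c = begin
  indicator (P zero) + count (P ∘ suc)  ≡⟨ cong (_+ count (P ∘ suc)) (indicator-false zero-fails) ⟩
  count (P ∘ suc)                       ≤⟨ count≤1 (P ∘ suc) c only-c′ ⟩
  1                                     ∎
  where
  open ≤-Reasoning
  zero-fails : ¬ T (P zero)
  zero-fails P0 with only-c zero P0
  ... | ()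
  only-c′ : ∀ i → T (P (suc i)) → i ≡ c
  only-c′ i Pi = Fin.suc-injective (only-c (suc i) Pi)

count-positive : ∀ {n} (P : Fin n → Bool) {c} → T (P c) → 1 ≤ count P
count-positive P {zero}  Pc =
  ≤-trans (≤-reflexive (cong indicator (sym (Equivalence.to T-≡ Pc)))) (m≤m+n _ _)
count-positive P {suc c} Pc = ≤-trans (count-positive (P ∘ suc) Pc) (m≤n+m _ _)

later-absent : ∀ {n} (P : Fin (suc n) → Bool) → count P ≤ 1 → T (P zero) → count (P ∘ suc) ≤ 0
later-absent P P≤1 P0 =
  ≤-pred (subst (λ b → indicator b + count (P ∘ suc) ≤ 1) (Equivalence.to T-≡ P0) P≤1)

count-unique : ∀ {n} (P : Fin n → Bool) {i j} → count P ≤ 1 → T (P i) → T (P j) → i ≡ j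
count-unique P {zero}  {zero}  _   _  _  = refl
count-unique P {zero}  {suc j} P≤1 Pi Pj =
  ⊥-elim (1≰0 (≤-trans (count-positive (P ∘ suc) Pj) (later-absent P P≤1 Pi)))
  where
  1≰0 : ¬ 1 ≤ 0
  1≰0 ()
count-unique P {suc i} {zero}  P≤1 Pi Pj = sym (count-unique P P≤1 Pj Pi)
count-unique P {suc i} {suc j} P≤1 Pi Pj =
  cong suc (count-unique (P ∘ suc) (≤-trans (m≤n+m _ (indicator (P zero))) P≤1) Pi Pj)

count-split : ∀ {n} (P Q : Fin n → Bool) →
              count P ≡ count (λ i → P i ∧ Q i) + count (λ i → P i ∧ not (Q i))
count-split P Q = trans (sum-cong-≗ (λ i → split (P i) (Q i)))
                        (∑-distrib-+ (λ i → indicator (P i ∧ Q i)) (λ i → indicator (P i ∧ not (Q i))))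
  where
  split : ∀ b c → indicator b ≡ indicator (b ∧ c) + indicator (b ∧ not c)
  split false _     = refl
  split true  true  = refl
  split true  false = refl

rank : ∀ {n} → (Fin n → Bool) → Fin n → ℕ
rank P zero    = 0
rank P (suc i) = indicator (P zero) + rank (P ∘ suc) i

count-first : ∀ {n} (P : Fin n → Bool) m → count (λ i → P i ∧ (rank P i <ᵇ m)) ≡ m ⊓ count P
count-first {zero}  P m = sym (⊓-zeroʳ m)
count-first {suc n} P m with P zero
... | false = count-first (P ∘ suc) m
count-first {suc n} P zero    | true =
  trans (sum-cong-≗ (λ i → cong indicator (∧-zeroʳ (P (suc i))))) (sum-zero n)
count-first {suc n} P (suc m) | true = cong suc (count-first (P ∘ suc) m)

<ᵇ-double : ∀ ρ q → T (ρ <ᵇ q) → (ρ <ᵇ q + q) ≡ true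
<ᵇ-double ρ q ρ<q = Equivalence.to T-≡ (<⇒<ᵇ (<-≤-trans (<ᵇ⇒< ρ q ρ<q) (m≤m+n q q)))

module Dealing {n} (P : Fin n → Bool) (q : ℕ) (room : q + q ≤ count P) where

  first : Fin n → Bool
  first i = rank P i <ᵇ q

  firstTwo : Fin n → Bool
  firstTwo i = rank P i <ᵇ q + q

  second : Fin n → Bool
  second i = not (first i) ∧ firstTwo i

  count-firstTwo : count (λ i → P i ∧ firstTwo i) ≡ q + q
  count-firstTwo = trans (count-first P (q + q)) (m≤n⇒m⊓n≡m room)

  dealt-first : count (λ i → P i ∧ first i) ≡ q
  dealt-first = trans (count-first P q) (m≤n⇒m⊓n≡m (≤-trans (m≤m+n q q) room))

  dealt-rest : count (λ i → P i ∧ not (firstTwo i)) ≡ count P ∸ (q + q)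
  dealt-rest = begin
    rest                                        ≡⟨ m+n∸m≡n (q + q) rest ⟨
    q + q + rest ∸ (q + q)                      ≡⟨ cong (λ x → x + rest ∸ (q + q)) count-firstTwo ⟨
    count (λ i → P i ∧ firstTwo i) + rest ∸ (q + q) ≡⟨ cong (_∸ (q + q)) (count-split P firstTwo) ⟨
    count P ∸ (q + q)                           ∎
    where
    open ≡-Reasoning
    rest = count (λ i → P i ∧ not (firstTwo i))

  first⇒firstTwo : ∀ b i → (b ∧ firstTwo i) ∧ first i ≡ b ∧ first i
  first⇒firstTwo b i with first i in below-q
  ... | false = trans (∧-zeroʳ _) (sym (∧-zeroʳ b))
  ... | true  rewrite <ᵇ-double (rank P i) q (Equivalence.from T-≡ below-q) = ∧-identityʳ _

  reorder : ∀ a b c → (a ∧ b) ∧ not c ≡ a ∧ (not c ∧ b)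
  reorder a b c rewrite ∧-assoc a b (not c) | ∧-comm b (not c) = refl

  dealt-second : count (λ i → P i ∧ second i) ≡ q
  dealt-second = +-cancelˡ-≡ q _ _ (begin
    q + count (λ i → P i ∧ second i)
      ≡⟨ cong₂ _+_ dealt-first (sum-cong-≗ (λ i → cong indicator (reorder (P i) (firstTwo i) (first i)))) ⟨
    count (λ i → P i ∧ first i) + count (λ i → (P i ∧ firstTwo i) ∧ not (first i))
      ≡⟨ cong (_+ count (λ i → (P i ∧ firstTwo i) ∧ not (first i)))
              (sum-cong-≗ (λ i → cong indicator (first⇒firstTwo (P i) i))) ⟨
    count (λ i → (P i ∧ firstTwo i) ∧ first i) + count (λ i → (P i ∧ firstTwo i) ∧ not (first i))
      ≡⟨ count-split (λ i → P i ∧ firstTwo i) first ⟨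
    count (λ i → P i ∧ firstTwo i)
      ≡⟨ count-firstTwo ⟩
    q + q ∎)
    where open ≡-Reasoning

-- What is known about a coin: whether, consistently with all outcomes so far, it may be
-- the alternator about to act fake, resp. about to act real, at its next weighing.
Status : Set
Status = Bool × Bool

pattern unknown = (true  , true)
pattern fake    = (true  , false)
pattern real    = (false , true)
pattern cleared = (false , false)

-- possible κ s: a coin of status κ may be the alternator with next behaviour s
-- (s = true: acts fake, as in Defs).
possible : Status → Bool → Bool
possible (mayFake , _) true  = mayFake
possible (_ , mayReal) false = mayReal

isAlive : Status → Bool
isAlive (mayFake , mayReal) = mayFake ∨ mayReal

alive-if-possible : ∀ κ s → T (possible κ s) → T (isAlive κ)
alive-if-possible unknown _     _ = _
alive-if-possible fake    true  _ = _
alive-if-possible real    false _ = _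

possible-if-alive : ∀ κ → T (isAlive κ) → ∃ λ s → T (possible κ s)
possible-if-alive unknown _ = true , _
possible-if-alive fake    _ = true , _
possible-if-alive real    _ = false , _

_≟ˢ_ : (κ κ′ : Status) → Dec (κ ≡ κ′)
_≟ˢ_ = ≡-dec Bool._≟_ Bool._≟_

_=ˢ_ : Status → Status → Bool
κ =ˢ κ′ = does (κ ≟ˢ κ′)

data Pan : Set where
  onLeft onRight offScale : Pan

_=ᵖ_ : Pan → Pan → Bool
onLeft   =ᵖ onLeft   = true
onRight  =ᵖ onRight  = true
offScale =ᵖ offScale = true
_        =ᵖ _        = false

panOf : ∀ {N} → Weighing N → Fin N → Pan
panOf W i with onPan (left W) i | onPan (right W) i
... | true  | _     = onLeft
... | false | true  = onRight
... | false | false = offScale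

weighOutcome : Pan → Bool → Outcome
weighOutcome onLeft  true = leftLighter
weighOutcome onRight true = rightLighter
weighOutcome _       _    = balance

afterWeigh : Pan → Bool → Bool
afterWeigh offScale s = s
afterWeigh onLeft   s = not s
afterWeigh onRight  s = not s

outcome-via-pan : ∀ {N} (W : Weighing N) i s → outcome W i s ≡ weighOutcome (panOf W i) s
outcome-via-pan W i s with onPan (left W) i | onPan (right W) i | s
... | true  | _     | true  = refl
... | true  | _     | false = refl
... | false | true  | true  = refl
... | false | true  | false = refl
... | false | false | _     = refl

nextState-via-pan : ∀ {N} (W : Weighing N) i s → nextState W i s ≡ afterWeigh (panOf W i) s
nextState-via-pan W i s with onPan (left W) i | onPan (right W) i
... | true  | _     = refl
... | false | true  = refl
... | false | false = refl

-- On a pan,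
-- a lighter outcome on its side means it acted fake (so acts real next), a balance means
-- it acted real (so acts fake next); off the scale only a balance is consistent.
refine : Pan → Outcome → Status → Status
refine offScale balance      κ                 = κ
refine offScale _            _                 = cleared
refine onLeft   leftLighter  (mayFake , _)     = (false , mayFake)
refine onLeft   balance      (_ , mayReal)     = (mayReal , false)
refine onLeft   rightLighter _                 = cleared
refine onRight  rightLighter (mayFake , _)     = (false , mayFake)
refine onRight  balance      (_ , mayReal)     = (mayReal , false)
refine onRight  leftLighter  _                 = cleared

refine-keeps : ∀ p κ s → T (possible κ s) →
               T (possible (refine p (weighOutcome p s) κ) (afterWeigh p s))
refine-keeps offScale κ s     ok = ok
refine-keeps onLeft   κ true  ok = ok
refine-keeps onLeft   κ false ok = ok
refine-keeps onRight  κ true  ok = ok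
refine-keeps onRight  κ false ok = ok

nothing-possible : ∀ s → ¬ T (possible cleared s)
nothing-possible true  ()
nothing-possible false ()

refine-exact : ∀ p o κ s′ → T (possible (refine p o κ) s′) →
               ∃ λ s → T (possible κ s) × weighOutcome p s ≡ o × afterWeigh p s ≡ s′
refine-exact offScale balance      κ s′    ok = s′ , ok , refl , refl
refine-exact onLeft   leftLighter  κ false ok = true , ok , refl , refl
refine-exact onLeft   balance      κ true  ok = false , ok , refl , refl
refine-exact onRight  rightLighter κ false ok = true , ok , refl , refl
refine-exact onRight  balance      κ true  ok = false , ok , refl , refl
refine-exact offScale leftLighter  κ s′    ok = ⊥-elim (nothing-possible s′ ok)
refine-exact offScale rightLighter κ s′    ok = ⊥-elim (nothing-possible s′ ok)
refine-exact onLeft   rightLighter κ s′    ok = ⊥-elim (nothing-possible s′ ok)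
refine-exact onRight  leftLighter  κ s′    ok = ⊥-elim (nothing-possible s′ ok)
refine-exact onLeft   leftLighter  κ true  ()
refine-exact onLeft   balance      κ false ()
refine-exact onRight  rightLighter κ true  ()
refine-exact onRight  balance      κ false ()

State : ℕ → Set
State N = Fin N → Status

FindsOn : ∀ {N k} → Strategy N k → State N → Set
FindsOn {N} S σ = ∀ (i : Fin N) s → T (possible (σ i) s) → run S i s ≡ i

after : ∀ {N} → Weighing N → State N → Outcome → State N
after W σ o i = refine (panOf W i) o (σ i)

finds-weigh : ∀ {N k} (W : Weighing N) (f : Outcome → Strategy N k) (σ : State N) →
              (∀ o → FindsOn (f o) (after W σ o)) → FindsOn (weigh W f) σ
finds-weigh W f σ finds i s ok
  rewrite outcome-via-pan W i s | nextState-via-pan W i s =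
  finds _ i _ (refine-keeps (panOf W i) (σ i) s ok)

finds-after : ∀ {N k} (W : Weighing N) (f : Outcome → Strategy N k) (σ : State N) →
              FindsOn (weigh W f) σ → ∀ o → FindsOn (f o) (after W σ o)
finds-after W f σ finds o i s′ ok with refine-exact (panOf W i) o (σ i) s′ ok
... | s , ok′ , refl , refl = begin
  run (f (weighOutcome (panOf W i) s)) i (afterWeigh (panOf W i) s)
    ≡⟨ cong₂ (λ o′ s″ → run (f o′) i s″) (outcome-via-pan W i s) (nextState-via-pan W i s) ⟨
  run (weigh W f) i s
    ≡⟨ finds i s ok′ ⟩
  i ∎
  where open ≡-Reasoning

Cell : Set
Cell = Status × Pan

statuses : List Status
statuses = unknown ∷ fake ∷ real ∷ cleared ∷ []

pans : List Pan
pans = onLeft ∷ onRight ∷ offScale ∷ []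

status-listed : ∀ κ → κ ∈ statuses
status-listed unknown = here refl
status-listed fake    = there (here refl)
status-listed real    = there (there (here refl))
status-listed cleared = there (there (there (here refl)))

pan-listed : ∀ p → p ∈ pans
pan-listed onLeft   = here refl
pan-listed onRight  = there (here refl)
pan-listed offScale = there (there (here refl))

-- A decidable property of cells holds everywhere once it is checked on all twelve;
-- the check is carried out by evaluation.
everyCell : {P : Status → Pan → Set} (P? : ∀ κ p → Dec (P κ p)) →
            {True (All.all? (λ c → P? (proj₁ c) (proj₂ c)) (cartesianProduct statuses pans))} →
            ∀ κ p → P κ p
everyCell P? {checked} κ p =
  All.lookup (toWitness checked) (∈-cartesianProduct⁺ (status-listed κ) (pan-listed p))

inCell : Cell → Status → Pan → Bool
inCell (κ₀ , p₀) κ p = (κ =ˢ κ₀) ∧ (p =ᵖ p₀)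

hits : List Cell → Status → Pan → ℕ
hits cs κ p = listSum (List.map (λ c → indicator (inCell c κ p)) cs)

count-by-cells : ∀ {N} (σ : State N) (π : Fin N → Pan) (g : Status → Pan → Bool) (cs : List Cell) →
                 (∀ κ p → indicator (g κ p) ≡ hits cs κ p) →
                 count (λ i → g (σ i) (π i))
                   ≡ listSum (List.map (λ c → count (λ i → inCell c (σ i) (π i))) cs)
count-by-cells σ π g cs table =
  trans (sum-cong-≗ (λ i → table (σ i) (π i)))
        (sum-exchange cs (λ c i → indicator (inCell c (σ i) (π i))))

column : Pan → List Cell
column p = (unknown , p) ∷ (fake , p) ∷ (real , p) ∷ (cleared , p) ∷ []

column-table : ∀ p₀ κ p → indicator (p =ᵖ p₀) ≡ hits (column p₀) κ p
column-table onLeft   = everyCell (λ κ p → _ ≟ _)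
column-table onRight  = everyCell (λ κ p → _ ≟ _)
column-table offScale = everyCell (λ κ p → _ ≟ _)

-- The cells from which a coin reaches status κ′ after outcome o, for κ′ other than cleared:
-- after a balance the scale coins that may act real become fake and the off-scale coins keep
-- their status; after a lighter pan only coins on it that may act fake remain, now real.
preimage : Outcome → Status → List Cell
preimage balance      unknown = (unknown , offScale) ∷ []
preimage balance      fake    = (fake , offScale) ∷ (unknown , onLeft) ∷ (unknown , onRight)
                                ∷ (real , onLeft) ∷ (real , onRight) ∷ []
preimage balance      real    = (real , offScale) ∷ []
preimage leftLighter  real    = (unknown , onLeft) ∷ (fake , onLeft) ∷ []
preimage rightLighter real    = (unknown , onRight) ∷ (fake , onRight) ∷ []
preimage _            _       = []

preimage-table : ∀ o κ′ → T (isAlive κ′) →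
                 ∀ κ p → indicator (refine p o κ =ˢ κ′) ≡ hits (preimage o κ′) κ p
preimage-table balance      unknown _ = everyCell (λ κ p → _ ≟ _)
preimage-table balance      fake    _ = everyCell (λ κ p → _ ≟ _)
preimage-table balance      real    _ = everyCell (λ κ p → _ ≟ _)
preimage-table leftLighter  unknown _ = everyCell (λ κ p → _ ≟ _)
preimage-table leftLighter  fake    _ = everyCell (λ κ p → _ ≟ _)
preimage-table leftLighter  real    _ = everyCell (λ κ p → _ ≟ _)
preimage-table rightLighter unknown _ = everyCell (λ κ p → _ ≟ _)
preimage-table rightLighter fake    _ = everyCell (λ κ p → _ ≟ _)
preimage-table rightLighter real    _ = everyCell (λ κ p → _ ≟ _)
preimage-table _            cleared ()

real-survives-balance : ∀ κ p →
  indicator (possible κ false) ≤ indicator (isAlive (refine p balance κ))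
real-survives-balance = everyCell (λ κ p → _ ≤? _)

candidates-split : ∀ κ p → indicator (isAlive κ) ≤
  indicator (isAlive (refine p balance κ)) + indicator (possible (refine p leftLighter κ) false)
                                           + indicator (possible (refine p rightLighter κ) false)
candidates-split = everyCell (λ κ p → _ ≤? _)

capacity : ∀ {N k} (S : Strategy N k) (σ : State N) → FindsOn S σ →
           count (λ i → possible (σ i) false) ≤ Jac (suc k) × count (isAlive ∘ σ) ≤ Jac (suc (suc k))
capacity {k = k} (guess c) σ finds =
  ≤-trans (≤-trans reals≤alive alive≤1) (Jac-positive k) , ≤-trans alive≤1 (Jac-positive (suc k))
  where
  alive≤1 : count (isAlive ∘ σ) ≤ 1
  alive≤1 = count≤1 (isAlive ∘ σ) c λ i alive →
    let (s , ok) = possible-if-alive (σ i) alive in sym (finds i s ok)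
  reals≤alive : count (λ i → possible (σ i) false) ≤ count (isAlive ∘ σ)
  reals≤alive = count-mono (λ i → alive-if-possible (σ i) false)
capacity {k = suc k} (weigh W f) σ finds = reals , alive
  where
  child : Outcome → State _
  child = after W σ
  IH : ∀ o → count (λ i → possible (child o i) false) ≤ Jac (suc k)
           × count (isAlive ∘ child o) ≤ Jac (suc (suc k))
  IH o = capacity (f o) (child o) (finds-after W f σ finds o)
  reals : count (λ i → possible (σ i) false) ≤ Jac (suc (suc k))
  reals = ≤-trans (sum-mono (λ i → real-survives-balance (σ i) (panOf W i))) (proj₂ (IH balance))
  alive : count (isAlive ∘ σ) ≤ Jac (suc (suc (suc k)))
  alive = begin
    count (isAlive ∘ σ)
      ≤⟨ sum-mono (λ i → candidates-split (σ i) (panOf W i)) ⟩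
    sum (λ i → indicator (isAlive (child balance i)) + indicator (possible (child leftLighter i) false)
                                                    + indicator (possible (child rightLighter i) false))
      ≡⟨ sum-three (λ i → indicator (isAlive (child balance i)))
                   (λ i → indicator (possible (child leftLighter i) false))
                   (λ i → indicator (possible (child rightLighter i) false)) ⟩
    count (isAlive ∘ child balance) + count (λ i → possible (child leftLighter i) false)
      + count (λ i → possible (child rightLighter i) false)
      ≤⟨ +-mono-≤ (+-mono-≤ (proj₂ (IH balance)) (proj₁ (IH leftLighter))) (proj₁ (IH rightLighter)) ⟩
    Jac (suc (suc k)) + Jac (suc k) + Jac (suc k)
      ≡⟨ jacobsthal-step (Jac (suc (suc k))) (Jac (suc k)) ⟩
    Jac (suc (suc (suc k))) ∎
    where
    open ≤-Reasoning
    jacobsthal-step : ∀ a b → a + b + b ≡ a + 2 * b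
    jacobsthal-step = solve-∀

too-few-weighings : ∀ N w k → Jac w < N → k < w → (S : Strategy N k) → ¬ Finds S
too-few-weighings N w k Jw<N k<w S finds = <-irrefl refl (<-≤-trans Jw<N N≤Jw)
  where
  N≤Jw : N ≤ Jac w
  N≤Jw = begin
    N                                   ≡⟨ count-all N ⟨
    count {N} (λ _ → true)              ≤⟨ proj₁ (capacity S (λ _ → unknown) (λ i s _ → finds i s)) ⟩
    Jac (suc k)                         ≤⟨ Jac-monotone k<w ⟩
    Jac w                               ∎
    where open ≤-Reasoning

toSubset : ∀ {N} → (Fin N → Bool) → Subset N
toSubset = tabulate

onPan-toSubset : ∀ {N} (b : Fin N → Bool) i → onPan (toSubset b) i ≡ b i
onPan-toSubset b i with lookup (toSubset b) i in entry
... | true  = trans (sym entry) (lookup∘tabulate b i)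
... | false = trans (sym entry) (lookup∘tabulate b i)

size-toSubset : ∀ {N} (b : Fin N → Bool) → ∣ toSubset b ∣ ≡ count b
size-toSubset {zero}  b = refl
size-toSubset {suc N} b with b zero
... | true  = cong suc (size-toSubset (b ∘ suc))
... | false = size-toSubset (b ∘ suc)

seatedWeighing : ∀ {N} (π : Fin N → Pan) →
                 count (λ i → π i =ᵖ onLeft) ≡ count (λ i → π i =ᵖ onRight) → Weighing N
seatedWeighing π balanced = record
  { left     = toSubset onLeftPan
  ; right    = toSubset onRightPan
  ; disjoint = λ (i , i∈both) → one-pan (π i) (trans (sym ([]=⇒lookup i∈both)) (in-both i))
  ; sameSize = trans (size-toSubset onLeftPan) (trans balanced (sym (size-toSubset onRightPan)))
  }
  where
  onLeftPan onRightPan : Fin _ → Bool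
  onLeftPan  i = π i =ᵖ onLeft
  onRightPan i = π i =ᵖ onRight
  in-both : ∀ i → lookup (toSubset onLeftPan ∩ toSubset onRightPan) i ≡ onLeftPan i ∧ onRightPan i
  in-both i = trans (lookup-zipWith _∧_ i (toSubset onLeftPan) (toSubset onRightPan))
                    (cong₂ _∧_ (lookup∘tabulate onLeftPan i) (lookup∘tabulate onRightPan i))
  one-pan : ∀ p → ¬ (true ≡ (p =ᵖ onLeft) ∧ (p =ᵖ onRight))
  one-pan onLeft   ()
  one-pan onRight  ()
  one-pan offScale ()

panOf-seated : ∀ {N} (π : Fin N → Pan) balanced i → panOf (seatedWeighing π balanced) i ≡ π i
panOf-seated π balanced i
  rewrite onPan-toSubset (λ j → π j =ᵖ onLeft) i | onPan-toSubset (λ j → π j =ᵖ onRight) i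
  with π i
... | onLeft   = refl
... | onRight  = refl
... | offScale = refl

slot : ℕ → ℕ → Pan
slot q ρ = if ρ <ᵇ q then onLeft else if ρ <ᵇ q + q then onRight else offScale

slotTest : Pan → ℕ → ℕ → Bool
slotTest onLeft   q ρ = ρ <ᵇ q
slotTest onRight  q ρ = not (ρ <ᵇ q) ∧ (ρ <ᵇ q + q)
slotTest offScale q ρ = not (ρ <ᵇ q + q)

slot-test : ∀ p q ρ → (slot q ρ =ᵖ p) ≡ slotTest p q ρ
slot-test onLeft q ρ with ρ <ᵇ q | ρ <ᵇ q + q
... | true  | _     = refl
... | false | true  = refl
... | false | false = refl
slot-test onRight q ρ with ρ <ᵇ q | ρ <ᵇ q + q
... | true  | _     = refl
... | false | true  = refl
... | false | false = refl
slot-test offScale q ρ with ρ <ᵇ q in below-q | ρ <ᵇ q + q in below-2q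
... | true  | true  = refl
... | true  | false =
  contradiction (trans (sym (<ᵇ-double ρ q (Equivalence.from T-≡ below-q))) below-2q) λ ()
... | false | true  = refl
... | false | false = refl

within-status : ∀ κ′ κ (F : Status → Bool) → (κ′ =ˢ κ) ∧ F κ′ ≡ (κ′ =ˢ κ) ∧ F κ
within-status κ′ κ F with κ′ ≟ˢ κ
... | yes refl = refl
... | no  _    = refl

census : ∀ {N} → State N → Status → ℕ
census σ κ = count (λ i → σ i =ˢ κ)

module Seating {N} (σ : State N) (quota : Status → ℕ)
               (fits : ∀ κ → quota κ + quota κ ≤ census σ κ) where

  sameAs : Status → Fin N → Bool
  sameAs κ i = σ i =ˢ κ

  seat : Fin N → Pan
  seat i = slot (quota (σ i)) (rank (sameAs (σ i)) i)

  cellSize : Cell → ℕ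
  cellSize c = count (λ i → inCell c (σ i) (seat i))

  expected : Cell → ℕ
  expected (κ , offScale) = census σ κ ∸ (quota κ + quota κ)
  expected (κ , _)        = quota κ

  cell-size : ∀ c → cellSize c ≡ expected c
  cell-size (κ , p) = trans (sum-cong-≗ λ i → cong indicator (as-dealt i)) (dealt p)
    where
    open Dealing (sameAs κ) (quota κ) (fits κ)
    as-dealt : ∀ i →
      (σ i =ˢ κ) ∧ (seat i =ᵖ p) ≡ sameAs κ i ∧ slotTest p (quota κ) (rank (sameAs κ) i)
    as-dealt i = trans (within-status (σ i) κ (λ κ′ → slot (quota κ′) (rank (sameAs κ′) i) =ᵖ p))
                       (cong (sameAs κ i ∧_) (slot-test p (quota κ) (rank (sameAs κ) i)))
    dealt : ∀ p →
      count (λ i → sameAs κ i ∧ slotTest p (quota κ) (rank (sameAs κ) i)) ≡ expected (κ , p)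
    dealt onLeft   = dealt-first
    dealt onRight  = dealt-second
    dealt offScale = dealt-rest

  count-expected : ∀ (g : Status → Pan → Bool) cs → (∀ κ p → indicator (g κ p) ≡ hits cs κ p) →
                   count (λ i → g (σ i) (seat i)) ≡ listSum (List.map expected cs)
  count-expected g cs table =
    trans (count-by-cells σ seat g cs table) (cong listSum (map-cong cell-size cs))

  -- Both pans receive the sum of all quotas.
  balanced : count (λ i → seat i =ᵖ onLeft) ≡ count (λ i → seat i =ᵖ onRight)
  balanced = trans (count-expected (λ _ p → p =ᵖ onLeft) (column onLeft) (column-table onLeft))
                   (sym (count-expected (λ _ p → p =ᵖ onRight) (column onRight) (column-table onRight)))

  weighing : Weighing N
  weighing = seatedWeighing seat balanced

  census-after : ∀ o κ′ → T (isAlive κ′) →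
                 census (after weighing σ o) κ′ ≡ listSum (List.map expected (preimage o κ′))
  census-after o κ′ alive =
    trans (sum-cong-≗ (λ i → cong (λ p → indicator (refine p o (σ i) =ˢ κ′))
                                  (panOf-seated seat balanced i)))
          (count-expected (λ κ p → refine p o κ =ˢ κ′) (preimage o κ′) (preimage-table o κ′ alive))

halves-fit : ∀ n → ⌊ n /2⌋ + ⌊ n /2⌋ ≤ n
halves-fit n = ≤-trans (+-monoʳ-≤ ⌊ n /2⌋ (⌊n/2⌋≤⌈n/2⌉ n)) (≤-reflexive (⌊n/2⌋+⌈n/2⌉≡n n))

leftover≤1 : ∀ n → n ∸ (⌊ n /2⌋ + ⌊ n /2⌋) ≤ 1
leftover≤1 zero          = z≤n
leftover≤1 (suc zero)    = ≤-refl
leftover≤1 (suc (suc n)) rewrite +-suc ⌊ n /2⌋ ⌊ n /2⌋ = leftover≤1 n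

half-small : ∀ {n} → n ≤ 1 → ⌊ n /2⌋ ≡ 0
half-small z≤n       = refl
half-small (s≤s z≤n) = refl

half-bound : ∀ n m → n ≤ 2 * m + 1 → ⌊ n /2⌋ ≤ m
half-bound zero          m       _                = z≤n
half-bound (suc zero)    m       _                = z≤n
half-bound (suc (suc n)) zero    (s≤s ())
half-bound (suc (suc n)) (suc m) (s≤s n+1≤2m+2) =
  s≤s (half-bound n m (≤-pred (subst (suc n ≤_) (shift m) n+1≤2m+2)))
  where
  shift : ∀ m → m + suc (m + 0) + 1 ≡ suc (2 * m + 1)
  shift = solve-∀

double-∸ : ∀ {q h} → q ≤ h → (h ∸ q) + (h ∸ q) ≡ (h + h) ∸ (q + q)
double-∸ {q} q≤h with m≤n⇒∃[o]m+o≡n q≤h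
... | d , refl rewrite m+n∸m≡n q d =
  sym (trans (cong (_∸ (q + q)) (regroup q d)) (m+n∸m≡n (q + q) (d + d)))
  where
  regroup : ∀ q d → q + d + (q + d) ≡ q + q + (d + d)
  regroup = solve-∀

capped-bound : ∀ h j e b → e ≤ b → h + h + e ≤ b + 2 * j → (h ∸ (h ⊓ j)) + (h ∸ (h ⊓ j)) + e ≤ b
capped-bound h j e b e≤b total with ≤-total h j
... | inj₁ h≤j rewrite m≤n⇒m⊓n≡m h≤j | n∸n≡0 h = e≤b
... | inj₂ j≤h rewrite m≥n⇒m⊓n≡n j≤h = +-cancelˡ-≤ (j + j) _ _ (begin
  j + j + ((h ∸ j) + (h ∸ j) + e)         ≡⟨ regroup j (h ∸ j) e ⟩
  (j + (h ∸ j)) + (j + (h ∸ j)) + e       ≡⟨ cong (λ x → x + x + e) (m+[n∸m]≡n j≤h) ⟩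
  h + h + e                               ≤⟨ total ⟩
  b + 2 * j                               ≡⟨ swap b j ⟩
  j + j + b                               ∎)
  where
  open ≤-Reasoning
  regroup : ∀ j d e → j + j + (d + d + e) ≡ (j + d) + (j + d) + e
  regroup = solve-∀
  swap : ∀ b j → b + 2 * j ≡ j + j + b
  swap = solve-∀

-- The invariant of the strategy, on the numbers u, f, r of coins that are unknown,
-- about to act fake, and about to act real: with k weighings left, either only unknown
-- coins or only real coins remain, at most Jac (k+1) of them, or the fake coins come in
-- pairs and at most one other candidate remains, Jac (k+2) candidates in all.
data Solvable (k : ℕ) : ℕ → ℕ → ℕ → Set where
  unknowns  : ∀ {u} → u ≤ Jac (suc k) → Solvable k u 0 0
  reals     : ∀ {r} → r ≤ Jac (suc k) → Solvable k 0 0 r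
  fakePairs : ∀ {h u r} → u + r ≤ 1 → h + h + (u + r) ≤ Jac (suc (suc k)) → Solvable k u (h + h) r

solvable-cong : ∀ {k u u′ f f′ r r′} → u ≡ u′ → f ≡ f′ → r ≡ r′ → Solvable k u f r → Solvable k u′ f′ r′
solvable-cong refl refl refl solvable = solvable

SolvableState : ∀ {N} → ℕ → State N → Set
SolvableState k σ = Solvable k (census σ unknown) (census σ fake) (census σ real)

fakeQuota : ℕ → ℕ → ℕ
fakeQuota k f = ⌊ f /2⌋ ⊓ Jac (suc k)

-- After a lighter pan only the coins on that pan that may act fake remain, now real.
solvable-lighter : ∀ {k u f r} → Solvable (suc k) u f r → Solvable k 0 0 (⌊ u /2⌋ + fakeQuota k f)
solvable-lighter {k} (unknowns u≤J) =
  reals (≤-trans (≤-reflexive (+-identityʳ _)) (half-bound _ _ (≤-trans u≤J (Jac-growth (suc k)))))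
solvable-lighter (reals _) = reals z≤n
solvable-lighter (fakePairs {u = u} u+r≤1 _) rewrite half-small (m+n≤o⇒m≤o u u+r≤1) = reals (m⊓n≤n _ _)

-- After a balance the unknown and real coins on the scale become fake.
solvable-balance : ∀ {k u f r} → Solvable (suc k) u f r →
  Solvable k (u ∸ (⌊ u /2⌋ + ⌊ u /2⌋))
             (f ∸ (fakeQuota k f + fakeQuota k f) + (⌊ u /2⌋ + ⌊ u /2⌋) + (⌊ r /2⌋ + ⌊ r /2⌋))
             (r ∸ (⌊ r /2⌋ + ⌊ r /2⌋))
solvable-balance {k} (unknowns {u} u≤J) =
  subst (λ f → Solvable k (u ∸ (⌊ u /2⌋ + ⌊ u /2⌋)) f 0) (sym (+-identityʳ _))
        (fakePairs {h = ⌊ u /2⌋} (≤-trans (≤-reflexive (+-identityʳ _)) (leftover≤1 u))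
                                 (≤-trans (≤-reflexive all-u) u≤J))
  where
  all-u : ⌊ u /2⌋ + ⌊ u /2⌋ + (u ∸ (⌊ u /2⌋ + ⌊ u /2⌋) + 0) ≡ u
  all-u = trans (cong (⌊ u /2⌋ + ⌊ u /2⌋ +_) (+-identityʳ _)) (m+[n∸m]≡n (halves-fit u))
solvable-balance (reals {r} r≤J) =
  fakePairs {h = ⌊ r /2⌋} (leftover≤1 r) (≤-trans (≤-reflexive (m+[n∸m]≡n (halves-fit r))) r≤J)
solvable-balance {k} (fakePairs {h} {u} {r} u+r≤1 total)
  rewrite half-small (m+n≤o⇒m≤o u u+r≤1) | half-small (m+n≤o⇒m≤o r (subst (_≤ 1) (+-comm u r) u+r≤1))
        | sym (n≡⌊n+n/2⌋ h) =
  subst (λ f → Solvable k u f r) fakes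
        (fakePairs {h = h ∸ q} u+r≤1
          (capped-bound h (Jac (suc k)) (u + r) _ (≤-trans u+r≤1 (Jac-positive (suc k))) total))
  where
  q = h ⊓ Jac (suc k)
  fakes : (h ∸ q) + (h ∸ q) ≡ (h + h) ∸ (q + q) + 0 + 0
  fakes = trans (double-∸ (m⊓n≤m h (Jac (suc k)))) (sym (trans (+-identityʳ _) (+-identityʳ _)))

solvable-leaf : ∀ {u f r} → Solvable 0 u f r → u + f + r ≤ 1
solvable-leaf (unknowns u≤1) = ≤-trans (≤-reflexive (trans (+-identityʳ _) (+-identityʳ _))) u≤1
solvable-leaf (reals r≤1)    = r≤1
solvable-leaf (fakePairs {h} {u} {r} _ total) = ≤-trans (≤-reflexive (regroup h u r)) total
  where
  regroup : ∀ h u r → u + (h + h) + r ≡ h + h + (u + r)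
  regroup = solve-∀

quotas : ∀ {N} → ℕ → State N → Status → ℕ
quotas k σ unknown = ⌊ census σ unknown /2⌋
quotas k σ fake    = fakeQuota k (census σ fake)
quotas k σ real    = ⌊ census σ real /2⌋
quotas k σ cleared = 0

quotas-fit : ∀ {N} k (σ : State N) κ → quotas k σ κ + quotas k σ κ ≤ census σ κ
quotas-fit k σ unknown = halves-fit _
quotas-fit k σ fake    =
  ≤-trans (+-mono-≤ (m⊓n≤m half (Jac (suc k))) (m⊓n≤m half (Jac (suc k)))) (halves-fit _)
  where
  half = ⌊ census σ fake /2⌋
quotas-fit k σ real    = halves-fit _
quotas-fit k σ cleared = z≤n

nextWeighing : ∀ {N} → ℕ → State N → Weighing N
nextWeighing k σ = Seating.weighing σ (quotas k σ) (quotas-fit k σ)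

firstAlive : ∀ {N} → Fin N → State N → Fin N
firstAlive default σ with any? (λ i → T? (isAlive (σ i)))
... | yes (i , _) = i
... | no  _       = default

strategy : ∀ {N} k → Fin N → State N → Strategy N k
strategy zero    default σ = guess (firstAlive default σ)
strategy (suc k) default σ = weigh W (λ o → strategy k default (after W σ o))
  where
  W = nextWeighing k σ

census-alive : ∀ {N} (σ : State N) →
               count (isAlive ∘ σ) ≡ census σ unknown + census σ fake + census σ real
census-alive σ = trans (sum-cong-≗ (λ i → by-status (σ i)))
  (sum-three (λ i → indicator (σ i =ˢ unknown)) (λ i → indicator (σ i =ˢ fake))
             (λ i → indicator (σ i =ˢ real)))
  where
  by-status : ∀ κ →
    indicator (isAlive κ) ≡ indicator (κ =ˢ unknown) + indicator (κ =ˢ fake) + indicator (κ =ˢ real)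
  by-status unknown = refl
  by-status fake    = refl
  by-status real    = refl
  by-status cleared = refl

next-solvable : ∀ {N} k (σ : State N) → SolvableState (suc k) σ →
                ∀ o → SolvableState k (after (nextWeighing k σ) σ o)
next-solvable k σ solvable balance = solvable-cong
  (sym (trans (census-after balance unknown _) (+-identityʳ _)))
  (sym (trans (census-after balance fake _) (regroup (census σ fake ∸ (qf + qf)) qu qr)))
  (sym (trans (census-after balance real _) (+-identityʳ _)))
  (solvable-balance solvable)
  where
  open Seating σ (quotas k σ) (quotas-fit k σ)
  qu = quotas k σ unknown
  qf = quotas k σ fake
  qr = quotas k σ real
  regroup : ∀ a b c → a + (b + (b + (c + (c + 0)))) ≡ a + (b + b) + (c + c)
  regroup = solve-∀
next-solvable k σ solvable leftLighter = solvable-cong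
  (sym (census-after leftLighter unknown _)) (sym (census-after leftLighter fake _))
  (sym (trans (census-after leftLighter real _) (cong (quotas k σ unknown +_) (+-identityʳ _))))
  (solvable-lighter solvable)
  where open Seating σ (quotas k σ) (quotas-fit k σ)
next-solvable k σ solvable rightLighter = solvable-cong
  (sym (census-after rightLighter unknown _)) (sym (census-after rightLighter fake _))
  (sym (trans (census-after rightLighter real _) (cong (quotas k σ unknown +_) (+-identityʳ _))))
  (solvable-lighter solvable)
  where open Seating σ (quotas k σ) (quotas-fit k σ)

strategy-finds : ∀ {N} k (default : Fin N) (σ : State N) →
                 SolvableState k σ → FindsOn (strategy k default σ) σ
strategy-finds zero default σ solvable i s ok with any? (λ j → T? (isAlive (σ j)))
... | yes (j , alive-j) = count-unique (isAlive ∘ σ) alive≤1 alive-j (alive-if-possible (σ i) s ok)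
  where
  alive≤1 : count (isAlive ∘ σ) ≤ 1
  alive≤1 = ≤-trans (≤-reflexive (census-alive σ)) (solvable-leaf solvable)
... | no  none          = contradiction (i , alive-if-possible (σ i) s ok) none
strategy-finds (suc k) default σ solvable =
  finds-weigh W (λ o → strategy k default (after W σ o)) σ
              (λ o → strategy-finds k default (after W σ o) (next-solvable k σ solvable o))
  where
  W = nextWeighing k σ

mainTheorem6 : (w : ℕ) → 1 ≤ w → (N : ℕ) → J w < N → N ≤ J (suc w) → aIs N w
mainTheorem6 w _ zero    () _
mainTheorem6 w _ (suc n) Jw<N N≤J =
  (strategy w zero allUnknown , λ i s → strategy-finds w zero allUnknown start i s (anything-possible s)) ,
  (λ k k<w → too-few-weighings (suc n) w k (subst (_< suc n) (J≡Jac w) Jw<N) k<w)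
  where
  anything-possible : ∀ s → T (possible unknown s)
  anything-possible true  = _
  anything-possible false = _
  allUnknown : State (suc n)
  allUnknown _ = unknown
  start : SolvableState w allUnknown
  start = solvable-cong (sym (count-all (suc n))) (sym (sum-zero (suc n))) (sym (sum-zero (suc n)))
                        (unknowns (subst (suc n ≤_) (J≡Jac (suc w)) N≤J))
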